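{- Let $D$ be the formal derivative with respect to the context-free grammar $G\colon x\to xy,\ y\to xz,\ z\to zw,\ w\to xz$. For $n\ge 1$ let $$Q_n(x,y,z,w)=\sum_{i,j}Q_n(i,j)\,x^i y^j z^{i} w^{n+1-2i-j},$$ where $Q_n(i,j)$ is the number of permutations of $[n]$ with $i$ peaks and $j$ double descents. Then for all $n\ge 1$, $$D^n(y)=Q_n(x,y,z,w).$$
   Context: Let $x,y,z,w$ be commuting variables. The formal derivative $D$ with respect to $G$ is the linear operator on Laurent polynomials in $x,y,z,w$ satisfying $D(uv)=uD(v)+vD(u)$, $D(c)=0$ for constants $c$, and $D(x)=xy$, $D(y)=xz$, $D(z)=zw$, $D(w)=xz$. For a permutation $\pi=\pi_1\cdots\pi_n$ of $[n]$, set $\pi_0=\pi_{n+1}=0$. For $1\le i\le n$, index $i$ is a peak if $\pi_{i-1}<\pi_i>\pi_{i+1}$, and a double descent if $\pi_{i-1}>\pi_i>\pi_{i+1}$. -}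

module Defs where

open import Data.Nat.Base using (ℕ; zero; suc; _+_; _*_; _∸_; _<ᵇ_; _≡ᵇ_)
open import Data.Bool.Base using (Bool; true; false; _∧_; if_then_else_)
open import Data.Product.Base using (_×_; _,_)
open import Data.List.Base using (List; []; _∷_; _++_; [_]; map; concatMap; filter; length; sum)
open import Data.List.Relation.Unary.Unique.DecPropositional using (unique?)
open import Data.Nat.Properties using (_≟_)

-- A monomial x^a y^b z^c w^d is the exponent tuple (a , b , c , d).
-- A polynomial is a finite formal sum (list) of (coefficient , monomial)
-- terms; two polynomials are compared via their coefficient functions.

Monomial : Set
Monomial = ℕ × ℕ × ℕ × ℕ

Poly : Set
Poly = List (ℕ × Monomial)

_·ₘ_ : Monomial → Monomial → Monomial
(a , b , c , d) ·ₘ (a' , b' , c' , d') = (a + a' , b + b' , c + c' , d + d')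

_==ₘ_ : Monomial → Monomial → Bool
(a , b , c , d) ==ₘ (a' , b' , c' , d') =
  (a ≡ᵇ a') ∧ (b ≡ᵇ b') ∧ (c ≡ᵇ c') ∧ (d ≡ᵇ d')

coeff : Poly → Monomial → ℕ
coeff [] m = 0
coeff ((k , m') ∷ p) m = (if m' ==ₘ m then k else 0) + coeff p m

varX varY varZ varW : Monomial
varX = (1 , 0 , 0 , 0)
varY = (0 , 1 , 0 , 0)
varZ = (0 , 0 , 1 , 0)
varW = (0 , 0 , 0 , 1)

Gx Gy Gz Gw : Monomial
Gx = (1 , 1 , 0 , 0)
Gy = (1 , 0 , 1 , 0)
Gz = (0 , 0 , 1 , 1)
Gw = (1 , 0 , 1 , 0)

-- The formal derivative on a monomial, by the Leibniz rule:
-- D(x^a y^b z^c w^d) = a x^(a-1) y^b z^c w^d D(x) + b x^a y^(b-1) z^c w^d D(y)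
--                    + c x^a y^b z^(c-1) w^d D(z) + d x^a y^b z^c w^(d-1) D(w)
-- (terms with zero exponent are omitted, as their coefficient is 0).
Dₘ : ℕ → Monomial → Poly
Dₘ k (a , b , c , d) = tx a ++ ty b ++ tz c ++ tw d
  where
  tx : ℕ → Poly
  tx zero = []
  tx (suc a') = [ (k * suc a' , (a' , b , c , d) ·ₘ Gx) ]
  ty : ℕ → Poly
  ty zero = []
  ty (suc b') = [ (k * suc b' , (a , b' , c , d) ·ₘ Gy) ]
  tz : ℕ → Poly
  tz zero = []
  tz (suc c') = [ (k * suc c' , (a , b , c' , d) ·ₘ Gz) ]
  tw : ℕ → Poly
  tw zero = []
  tw (suc d') = [ (k * suc d' , (a , b , c , d') ·ₘ Gw) ]

D : Poly → Poly
D [] = []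
D ((k , m) ∷ p) = Dₘ k m ++ D p

D^ : ℕ → Poly → Poly
D^ zero p = p
D^ (suc n) p = D (D^ n p)

polyY : Poly
polyY = [ (1 , varY) ]

oneTo : ℕ → List ℕ
oneTo zero = []
oneTo (suc n) = oneTo n ++ [ suc n ]

words : ℕ → ℕ → List (List ℕ)
words n zero = [ [] ]
words n (suc m) = concatMap (λ w → map (λ i → i ∷ w) (oneTo n)) (words n m)

perms : ℕ → List (List ℕ)
perms n = filter (unique? _≟_) (words n n)

-- count indices i (1 ≤ i ≤ n) whose triple (π_{i-1}, π_i, π_{i+1}) satisfies P,
-- with the convention π₀ = π_{n+1} = 0
countTriples : (ℕ → ℕ → ℕ → Bool) → List ℕ → ℕ
countTriples P (a ∷ b ∷ c ∷ rest) =
  (if P a b c then 1 else 0) + countTriples P (b ∷ c ∷ rest)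
countTriples P _ = 0

padded : List ℕ → List ℕ
padded π = 0 ∷ (π ++ [ 0 ])

isPeak isDD : ℕ → ℕ → ℕ → Bool
isPeak a b c = (a <ᵇ b) ∧ (c <ᵇ b)
isDD a b c = (b <ᵇ a) ∧ (c <ᵇ b)

pk dd : List ℕ → ℕ
pk π = countTriples isPeak (padded π)
dd π = countTriples isDD (padded π)

Qcount : ℕ → ℕ → ℕ → ℕ
Qcount n i j = length (filter (λ π → (pk π ≟ i)) (filter (λ π → dd π ≟ j) (perms n)))

zeroTo : ℕ → List ℕ
zeroTo n = 0 ∷ oneTo n

-- Q_n(x,y,z,w) = Σ_{i,j} Q_n(i,j) x^i y^j z^i w^(n+1-2i-j).
-- Q_n(i,j) = 0 unless 0 ≤ i, j ≤ n, so i and j range over 0..n.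
Qpoly : ℕ → Poly
Qpoly n = concatMap (λ i → map (λ j → (Qcount n i j , (i , j , i , suc n ∸ (2 * i + j)))) (zeroTo n)) (zeroTo n)

-- Give σ ∈ S_n the weight x^pk y^dd z^pk w^(n+1-2pk-dd) and let P_n be the sum of
-- all weights; grouping by (pk, dd) gives P_n = Q_n (coeff-Qpoly).  As D(y) = xz = P_1
-- and D acts on coefficient functions (D-resp), it suffices that D(P_n) = P_(n+1).
-- Each permutation of [n+1] arises once by inserting n+1 into a gap of the padded
-- word 0π0 of some π ∈ S_n (perms-suc).  Label an ascent into a peak by x, a descent
-- out of a double descent by y, a descent out of a peak by z and any other ascent by
-- w: inserting into a gap labelled τ applies the rule τ to the weight (gap-shift),
-- and τ labels as many gaps as the exponent of its variable (label-counts), so the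
-- insertions into π produce D(weight π) by the Leibniz rule (insertion-sum).

module Submission where

open import Defs
open import Data.Nat.Base using (ℕ; zero; suc; _+_; _*_; _∸_; _≤_; _<_; z≤n; s≤s; _<ᵇ_)
open import Data.Bool.Properties using (∧-zeroʳ; ∧-identityʳ)
open import Data.Nat.Properties
  using (_≟_; +-assoc; +-comm; +-suc; +-identityʳ; *-identityˡ; *-identityʳ; *-zeroʳ; *-assoc; *-comm;
         *-distribˡ-+; *-distribʳ-+; <⇒≤; <⇒≱; ≤-refl; <-irrefl; <-cmp; <⇒≢; <ᵇ⇒<; <⇒<ᵇ;
         m≤n⇒m≤1+n; ≤∧≢⇒<; 0≢1+n; suc-injective; m+n∸m≡n; +-∸-assoc; ∸-+-assoc; m≤m+n; +-commutativeSemigroup)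
open import Algebra.Properties.CommutativeSemigroup +-commutativeSemigroup using (interchange)
open import Data.Nat.ListAction using (sum)
open import Data.Nat.ListAction.Properties using (sum-++; sum-↭)
open import Data.Bool.Base using (Bool; true; false; if_then_else_; T)
open import Data.Product.Base using (_×_; _,_; proj₁; proj₂)
open import Data.Empty using (⊥-elim)
open import Data.Unit.Base using (tt)
open import Data.List.Base using (List; []; _∷_; _++_; [_]; map; concatMap; filter; length; applyUpTo)
open import Data.List.Properties using (∷-injectiveˡ; ∷-injectiveʳ; map-++; map-∘; length-++; length-applyUpTo; applyUpTo-∷ʳ)
open import Data.List.Relation.Unary.All using (All; []; _∷_)
import Data.List.Relation.Unary.All as All
open import Data.List.Relation.Unary.All.Properties using (¬Any⇒All¬; All¬⇒¬Any) renaming (++⁺ to All-++⁺)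
open import Data.List.Relation.Unary.Any using (here; there)
open import Data.List.Relation.Unary.AllPairs using ([]; _∷_)
open import Data.List.Relation.Unary.Linked using (Linked; [-]; _∷_)
open import Data.List.Relation.Unary.Linked.Properties using (AllPairs⇒Linked)
open import Data.List.Relation.Unary.Unique.Propositional using (Unique)
import Data.List.Relation.Unary.Unique.Propositional.Properties as Unique
open import Data.List.Relation.Binary.Disjoint.Propositional using (Disjoint)
open import Data.List.Relation.Binary.Pointwise using (Pointwise; []; _∷_)
import Data.List.Relation.Binary.Pointwise as Pointwise
open import Data.List.Relation.Binary.Permutation.Propositional using (_↭_; ↭-sym; ↭-trans; ↭-refl; prep; swap; ↭⇒↭ₛ)
open import Data.List.Relation.Binary.Permutation.Propositional.Properties
  using (map⁺; shift; ↭-length; All-resp-↭; ∈-resp-↭)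
import Data.List.Relation.Binary.Permutation.Setoid.Properties as ↭ₛ
open import Data.List.Relation.Binary.BagAndSetEquality using (∼bag⇒↭)
open import Data.List.Membership.Propositional using (_∈_; _∉_; find; lose)
open import Data.List.Membership.Propositional.Properties
  using (∈-∃++; ∈-map⁺; ∈-map⁻; ∈-filter⁺; ∈-filter⁻;
         ∈-concatMap⁺; ∈-concatMap⁻; ∈-applyUpTo⁺; ∈-applyUpTo⁻)
open import Data.List.Membership.DecPropositional _≟_ using (_∈?_)
open import Data.List.Relation.Unary.Unique.DecPropositional using (unique?)
open import Data.List.Membership.Propositional.Properties.WithK using (unique∧set⇒bag)
open import Data.Nat.Solver using (module +-*-Solver)
open +-*-Solver using (solve; _:+_; _:*_; _:=_; con)
open import Function.Base using (_∘_)
open import Function.Bundles using (_⇔_; mk⇔)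
open import Relation.Nullary using (¬_; Dec; yes; no; does; map′; _×-dec_)
open import Relation.Binary.Definitions using (DecidableEquality; tri<; tri≈; tri>)
open import Relation.Binary.PropositionalEquality
  using (_≡_; _≢_; refl; sym; trans; cong; cong₂; subst; setoid; module ≡-Reasoning)

∑ : {A : Set} → (A → ℕ) → List A → ℕ
∑ f xs = sum (map f xs)

∑-++ : {A : Set} (f : A → ℕ) (xs ys : List A) → ∑ f (xs ++ ys) ≡ ∑ f xs + ∑ f ys
∑-++ f xs ys = trans (cong sum (map-++ f xs ys)) (sum-++ (map f xs) (map f ys))

∑-map : {A B : Set} (f : B → ℕ) (g : A → B) (xs : List A) → ∑ f (map g xs) ≡ ∑ (f ∘ g) xs
∑-map f g xs = cong sum (sym (map-∘ xs))

∑-concatMap : {A B : Set} (f : B → ℕ) (g : A → List B) (xs : List A) →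
              ∑ f (concatMap g xs) ≡ ∑ (λ x → ∑ f (g x)) xs
∑-concatMap f g [] = refl
∑-concatMap f g (x ∷ xs) = trans (∑-++ f (g x) (concatMap g xs)) (cong (∑ f (g x) +_) (∑-concatMap f g xs))

∑-cong : {A : Set} {f g : A → ℕ} (xs : List A) → (∀ {x} → x ∈ xs → f x ≡ g x) → ∑ f xs ≡ ∑ g xs
∑-cong [] eq = refl
∑-cong (x ∷ xs) eq = cong₂ _+_ (eq (here refl)) (∑-cong xs (eq ∘ there))

∑-↭ : {A : Set} (f : A → ℕ) {xs ys : List A} → xs ↭ ys → ∑ f xs ≡ ∑ f ys
∑-↭ f p = sum-↭ (map⁺ f p)

∑-zero : {A : Set} (xs : List A) → ∑ (λ _ → 0) xs ≡ 0
∑-zero [] = refl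
∑-zero (x ∷ xs) = ∑-zero xs

∑-+ : {A : Set} (f g : A → ℕ) (xs : List A) → ∑ (λ x → f x + g x) xs ≡ ∑ f xs + ∑ g xs
∑-+ f g [] = refl
∑-+ f g (x ∷ xs) = trans (cong ((f x + g x) +_) (∑-+ f g xs)) (interchange (f x) (g x) (∑ f xs) (∑ g xs))

∑-*ˡ : {A : Set} (c : ℕ) (f : A → ℕ) (xs : List A) → c * ∑ f xs ≡ ∑ (λ x → c * f x) xs
∑-*ˡ c f [] = *-zeroʳ c
∑-*ˡ c f (x ∷ xs) = trans (*-distribˡ-+ c (f x) (∑ f xs)) (cong (c * f x +_) (∑-*ˡ c f xs))

∑-*ʳ : {A : Set} (f : A → ℕ) (xs : List A) (c : ℕ) → ∑ f xs * c ≡ ∑ (λ x → f x * c) xs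
∑-*ʳ f [] c = refl
∑-*ʳ f (x ∷ xs) c = trans (*-distribʳ-+ c (f x) (∑ f xs)) (cong (f x * c +_) (∑-*ʳ f xs c))

∑-swap : {A B : Set} (F : A → B → ℕ) (xs : List A) (ys : List B) →
         ∑ (λ x → ∑ (F x) ys) xs ≡ ∑ (λ y → ∑ (λ x → F x y) xs) ys
∑-swap F [] ys = sym (∑-zero ys)
∑-swap F (x ∷ xs) ys =
  trans (cong (∑ (F x) ys +_) (∑-swap F xs ys)) (sym (∑-+ (F x) (λ y → ∑ (λ x → F x y) xs) ys))

∑-exchange : {A B : Set} (u : A → ℕ) (v : B → ℕ) (h : A → B → ℕ) (xs : List A) (ys : List B) →
  ∑ (λ x → u x * ∑ (λ y → v y * h x y) ys) xs ≡ ∑ (λ y → v y * ∑ (λ x → u x * h x y) xs) ys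
∑-exchange u v h xs ys = begin
  ∑ (λ x → u x * ∑ (λ y → v y * h x y) ys) xs
    ≡⟨ ∑-cong xs (λ {x} _ → ∑-*ˡ (u x) (λ y → v y * h x y) ys) ⟩
  ∑ (λ x → ∑ (λ y → u x * (v y * h x y)) ys) xs
    ≡⟨ ∑-swap (λ x y → u x * (v y * h x y)) xs ys ⟩
  ∑ (λ y → ∑ (λ x → u x * (v y * h x y)) xs) ys
    ≡⟨ ∑-cong ys (λ {y} _ → ∑-cong xs (λ {x} _ → swap-factors (u x) (v y) (h x y))) ⟩
  ∑ (λ y → ∑ (λ x → v y * (u x * h x y)) xs) ys
    ≡⟨ ∑-cong ys (λ {y} _ → sym (∑-*ˡ (v y) (λ x → u x * h x y) xs)) ⟩
  ∑ (λ y → v y * ∑ (λ x → u x * h x y) xs) ys   ∎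
  where
  open ≡-Reasoning
  swap-factors : ∀ a b c → a * (b * c) ≡ b * (a * c)
  swap-factors a b c = trans (sym (*-assoc a b c)) (trans (cong (_* c) (*-comm a b)) (*-assoc b a c))

χ : {P : Set} → Dec P → ℕ
χ (yes _) = 1
χ (no _) = 0

length-filter² : {A : Set} {P Q : A → Set} (P? : ∀ x → Dec (P x)) (Q? : ∀ x → Dec (Q x)) (xs : List A) →
  length (filter P? (filter Q? xs)) ≡ ∑ (λ x → χ (Q? x) * χ (P? x)) xs
length-filter² P? Q? [] = refl
length-filter² P? Q? (x ∷ xs) with Q? x
... | no _ = length-filter² P? Q? xs
... | yes _ with P? x
...   | no _ = length-filter² P? Q? xs
...   | yes _ = cong suc (length-filter² P? Q? xs)

∑-const1 : {A : Set} (xs : List A) → ∑ (λ _ → 1) xs ≡ length xs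
∑-const1 [] = refl
∑-const1 (x ∷ xs) = cong suc (∑-const1 xs)

∑-Pointwise : {A B : Set} {R : A → B → Set} (f : A → ℕ) (g : B → ℕ) {xs : List A} {ys : List B} →
              (∀ x y → R x y → f x ≡ g y) → Pointwise R xs ys → ∑ f xs ≡ ∑ g ys
∑-Pointwise f g eq [] = refl
∑-Pointwise f g eq (r ∷ rs) = cong₂ _+_ (eq _ _ r) (∑-Pointwise f g eq rs)

Unique-↭ : {A : Set} {xs ys : List A} → xs ↭ ys → Unique xs → Unique ys
Unique-↭ p u = ↭ₛ.Unique-resp-↭ (setoid _) (↭⇒↭ₛ p) u

unique-sameMembers⇒↭ : {A : Set} {xs ys : List A} → Unique xs → Unique ys →
                        (∀ {z} → z ∈ xs ⇔ z ∈ ys) → xs ↭ ys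
unique-sameMembers⇒↭ ux uy same = ∼bag⇒↭ (unique∧set⇒bag ux uy same)

unique-⊆⇒length≤ : {A : Set} {xs ys : List A} → Unique xs → (∀ {z} → z ∈ xs → z ∈ ys) → length xs ≤ length ys
unique-⊆⇒length≤ {xs = []} _ _ = z≤n
unique-⊆⇒length≤ {xs = x ∷ xs} (x∉xs ∷ u) sub with ∈-∃++ (sub (here refl))
... | ys₁ , ys₂ , refl =
  subst (suc (length xs) ≤_) (sym (↭-length (shift x ys₁ ys₂))) (s≤s (unique-⊆⇒length≤ u sub′))
  where
  sub′ : ∀ {z} → z ∈ xs → z ∈ ys₁ ++ ys₂
  sub′ z∈xs with ∈-resp-↭ (shift x ys₁ ys₂) (sub (there z∈xs))
  ... | here refl = ⊥-elim (All¬⇒¬Any x∉xs z∈xs)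
  ... | there z∈ys = z∈ys

concatMap-unique : {A B : Set} (g : A → List B) {xs : List A} → Unique xs →
  (∀ {x} → x ∈ xs → Unique (g x)) →
  (∀ {x y z} → x ∈ xs → y ∈ xs → z ∈ g x → z ∈ g y → x ≡ y) →
  Unique (concatMap g xs)
concatMap-unique g {[]} _ _ _ = []
concatMap-unique g {x ∷ xs} (x∉xs ∷ u) uniq disj =
  Unique.++⁺ (uniq (here refl)) (concatMap-unique g u (uniq ∘ there) (λ p q → disj (there p) (there q))) apart
  where
  apart : Disjoint (g x) (concatMap g xs)
  apart (z∈gx , z∈rest) with find (∈-concatMap⁻ g z∈rest)
  ... | y , y∈xs , z∈gy = All.lookup x∉xs y∈xs (disj (here refl) (there y∈xs) z∈gx z∈gy)

Letter : ℕ → ℕ → Set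
Letter n x = 1 ≤ x × x ≤ n

oneTo-applyUpTo : ∀ n → oneTo n ≡ applyUpTo suc n
oneTo-applyUpTo zero = refl
oneTo-applyUpTo (suc n) = trans (cong (_++ [ suc n ]) (oneTo-applyUpTo n)) (applyUpTo-∷ʳ suc n)

∈-oneTo⁺ : ∀ {n x} → Letter n x → x ∈ oneTo n
∈-oneTo⁺ {n} {suc i} (s≤s z≤n , i<n) = subst (suc i ∈_) (sym (oneTo-applyUpTo n)) (∈-applyUpTo⁺ suc i<n)

∈-oneTo⁻ : ∀ {n x} → x ∈ oneTo n → Letter n x
∈-oneTo⁻ {n} x∈ with ∈-applyUpTo⁻ suc (subst (_ ∈_) (oneTo-applyUpTo n) x∈)
... | i , i<n , refl = s≤s z≤n , i<n

oneTo-unique : ∀ n → Unique (oneTo n)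
oneTo-unique n = subst Unique (sym (oneTo-applyUpTo n)) (Unique.applyUpTo⁺₁ suc n (λ i<j _ → <⇒≢ (s≤s i<j)))

length-oneTo : ∀ n → length (oneTo n) ≡ n
length-oneTo n = trans (cong length (oneTo-applyUpTo n)) (length-applyUpTo suc n)

∈-words⁺ : ∀ n (σ : List ℕ) → All (Letter n) σ → σ ∈ words n (length σ)
∈-words⁺ n [] [] = here refl
∈-words⁺ n (i ∷ σ) (i∈ ∷ σ∈) = ∈-concatMap⁺ _ (lose (∈-words⁺ n σ σ∈) (∈-map⁺ (λ j → j ∷ σ) (∈-oneTo⁺ i∈)))

∈-words⁻ : ∀ n m {σ} → σ ∈ words n m → length σ ≡ m × All (Letter n) σ
∈-words⁻ n zero (here refl) = refl , []
∈-words⁻ n (suc m) σ∈ with find (∈-concatMap⁻ (λ w → map (λ i → i ∷ w) (oneTo n)) {xs = words n m} σ∈)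
... | w , w∈ , σ∈′ with ∈-map⁻ (λ i → i ∷ w) σ∈′
... | i , i∈ , refl with ∈-words⁻ n m w∈
... | len , letters = cong suc len , ∈-oneTo⁻ i∈ ∷ letters

words-unique : ∀ n m → Unique (words n m)
words-unique n zero = [] ∷ []
words-unique n (suc m) =
  concatMap-unique _ (words-unique n m) (λ _ → Unique.map⁺ ∷-injectiveˡ (oneTo-unique n)) sameTail
  where
  sameTail : ∀ {w w′ z} → w ∈ words n m → w′ ∈ words n m →
             z ∈ map (λ i → i ∷ w) (oneTo n) → z ∈ map (λ i → i ∷ w′) (oneTo n) → w ≡ w′
  sameTail _ _ z∈ z∈′ with ∈-map⁻ (λ i → i ∷ _) z∈ | ∈-map⁻ (λ i → i ∷ _) z∈′
  ... | _ , _ , refl | _ , _ , refl = refl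

record IsPerm (n : ℕ) (σ : List ℕ) : Set where
  field
    length≡  : length σ ≡ n
    letters  : All (Letter n) σ
    distinct : Unique σ
open IsPerm

∈-perms⁺ : ∀ {n σ} → IsPerm n σ → σ ∈ perms n
∈-perms⁺ {n} {σ} p with length≡ p
... | refl = ∈-filter⁺ (unique? _≟_) (∈-words⁺ n σ (letters p)) (distinct p)

∈-perms⁻ : ∀ {n σ} → σ ∈ perms n → IsPerm n σ
∈-perms⁻ {n} σ∈ with ∈-filter⁻ (unique? _≟_) σ∈
... | σ∈words , u with ∈-words⁻ n n σ∈words
... | len , ls = record { length≡ = len ; letters = ls ; distinct = u }

perms-unique : ∀ n → Unique (perms n)
perms-unique n = Unique.filter⁺ (unique? _≟_) (words-unique n n)

IsPerm-↭ : ∀ {n σ σ′} → σ ↭ σ′ → IsPerm n σ → IsPerm n σ′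
IsPerm-↭ p isp = record
  { length≡ = trans (sym (↭-length p)) (length≡ isp)
  ; letters = All-resp-↭ p (letters isp)
  ; distinct = Unique-↭ p (distinct isp) }

max∉ : ∀ {n π} → IsPerm n π → suc n ∉ π
max∉ isp M∈π with All.lookup (letters isp) M∈π
... | _ , M≤n = <-irrefl refl M≤n

IsPerm-addMax : ∀ {n π} → IsPerm n π → IsPerm (suc n) (suc n ∷ π)
IsPerm-addMax {n} isp = record
  { length≡ = cong suc (length≡ isp)
  ; letters = (s≤s z≤n , ≤-refl) ∷ All.map (λ (l , u) → l , m≤n⇒m≤1+n u) (letters isp)
  ; distinct = ¬Any⇒All¬ _ (max∉ isp) ∷ distinct isp }

letter-lower : ∀ {n x} → Letter (suc n) x → x ≢ suc n → Letter n x
letter-lower (l , x≤M) x≢M with ≤∧≢⇒< x≤M x≢M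
... | s≤s x≤n = l , x≤n

IsPerm-dropMax : ∀ {n π} → IsPerm (suc n) (suc n ∷ π) → IsPerm n π
IsPerm-dropMax {n} isp with letters isp | distinct isp
... | _ ∷ ls | M∉π ∷ u = record
  { length≡ = suc-injective (length≡ isp)
  ; letters = All.zipWith (λ (l , M≢x) → letter-lower l (M≢x ∘ sym)) (ls , M∉π)
  ; distinct = u }

-- Pigeonhole: a permutation of [n+1] contains n+1.
max∈ : ∀ {n σ} → IsPerm (suc n) σ → suc n ∈ σ
max∈ {n} {σ} isp with suc n ∈? σ
... | yes M∈σ = M∈σ
... | no M∉σ = ⊥-elim (<-irrefl refl (subst (_≤ n) (length≡ isp) σ≤n))
  where
  σ⊆[n] : ∀ {x} → x ∈ σ → x ∈ oneTo n
  σ⊆[n] x∈σ = ∈-oneTo⁺ (letter-lower (All.lookup (letters isp) x∈σ) (λ { refl → M∉σ x∈σ }))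
  σ≤n : length σ ≤ n
  σ≤n = subst (length σ ≤_) (length-oneTo n) (unique-⊆⇒length≤ (distinct isp) σ⊆[n])

insertions : ℕ → List ℕ → List (List ℕ)
insertions M [] = [ [ M ] ]
insertions M (x ∷ π) = (M ∷ x ∷ π) ∷ map (x ∷_) (insertions M π)

insertion-↭ : ∀ M π {σ} → σ ∈ insertions M π → σ ↭ M ∷ π
insertion-↭ M [] (here refl) = ↭-refl
insertion-↭ M (x ∷ π) (here refl) = ↭-refl
insertion-↭ M (x ∷ π) (there σ∈) with ∈-map⁻ (x ∷_) σ∈
... | σ′ , σ′∈ , refl = ↭-trans (prep x (insertion-↭ M π σ′∈)) (swap x M ↭-refl)

∈-insertions : ∀ M π₁ π₂ → π₁ ++ M ∷ π₂ ∈ insertions M (π₁ ++ π₂)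
∈-insertions M [] [] = here refl
∈-insertions M [] (x ∷ π₂) = here refl
∈-insertions M (x ∷ π₁) π₂ = there (∈-map⁺ (x ∷_) (∈-insertions M π₁ π₂))

insertions-unique : ∀ M π → M ∉ π → Unique (insertions M π)
insertions-unique M [] _ = [] ∷ []
insertions-unique M (x ∷ π) M∉ =
  ¬Any⇒All¬ _ front∉ ∷ Unique.map⁺ ∷-injectiveʳ (insertions-unique M π (M∉ ∘ there))
  where
  front∉ : M ∷ x ∷ π ∉ map (x ∷_) (insertions M π)
  front∉ σ∈ with ∈-map⁻ (x ∷_) σ∈
  ... | _ , _ , refl = M∉ (here refl)

delete : ℕ → List ℕ → List ℕ
delete M [] = []
delete M (x ∷ σ) with x ≟ M
... | yes _ = σ
... | no _ = x ∷ delete M σ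

delete-front : ∀ M σ → delete M (M ∷ σ) ≡ σ
delete-front M σ with M ≟ M
... | yes _ = refl
... | no M≢M = ⊥-elim (M≢M refl)

delete-insertion : ∀ M π {σ} → M ∉ π → σ ∈ insertions M π → delete M σ ≡ π
delete-insertion M [] M∉ (here refl) = delete-front M []
delete-insertion M (x ∷ π) M∉ (here refl) = delete-front M (x ∷ π)
delete-insertion M (x ∷ π) M∉ (there σ∈) with ∈-map⁻ (x ∷_) σ∈
... | σ′ , σ′∈ , refl with x ≟ M
... | yes refl = ⊥-elim (M∉ (here refl))
... | no _ = cong (x ∷_) (delete-insertion M π (M∉ ∘ there) σ′∈)

perms-suc : ∀ n → perms (suc n) ↭ concatMap (insertions (suc n)) (perms n)
perms-suc n = unique-sameMembers⇒↭ (perms-unique (suc n)) insertionsUnique (mk⇔ to from)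
  where
  M = suc n
  insertionsUnique : Unique (concatMap (insertions M) (perms n))
  insertionsUnique = concatMap-unique (insertions M) (perms-unique n)
    (λ π∈ → insertions-unique M _ (max∉ (∈-perms⁻ π∈)))
    (λ π∈ π′∈ σ∈ σ∈′ → trans (sym (delete-insertion M _ (max∉ (∈-perms⁻ π∈)) σ∈))
                              (delete-insertion M _ (max∉ (∈-perms⁻ π′∈)) σ∈′))
  to : ∀ {σ} → σ ∈ perms M → σ ∈ concatMap (insertions M) (perms n)
  to σ∈ with ∈-∃++ (max∈ {n} (∈-perms⁻ σ∈))
  ... | π₁ , π₂ , refl = ∈-concatMap⁺ (insertions M) (lose (∈-perms⁺ π∈) (∈-insertions M π₁ π₂))
    where
    π∈ : IsPerm n (π₁ ++ π₂)
    π∈ = IsPerm-dropMax (IsPerm-↭ (shift M π₁ π₂) (∈-perms⁻ σ∈))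
  from : ∀ {σ} → σ ∈ concatMap (insertions M) (perms n) → σ ∈ perms M
  from σ∈ with find (∈-concatMap⁻ (insertions M) σ∈)
  ... | π , π∈ , σ∈ins = ∈-perms⁺ (IsPerm-↭ (↭-sym (insertion-↭ M π σ∈ins)) (IsPerm-addMax (∈-perms⁻ π∈)))

-- Decidable equality of monomials, testing the exponents in the order used by _==ₘ_.
_≟ₘ_ : DecidableEquality Monomial
(a , b , c , d) ≟ₘ (a′ , b′ , c′ , d′) =
  map′ (λ { (refl , refl , refl , refl) → refl }) (λ { refl → refl , refl , refl , refl })
       (a ≟ a′ ×-dec (b ≟ b′ ×-dec (c ≟ c′ ×-dec d ≟ d′)))

-- Kronecker delta on monomials; its test is definitionally the one used by coeff.
-- (Monomials are tuples, so m ≟ₘ t unfolds; facts about δ are therefore proved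
-- for an arbitrary decision d of m ≡ t.)
δ : Monomial → Monomial → ℕ
δ m t = if does (m ≟ₘ t) then 1 else 0

δ-off : ∀ e m t → m ≢ t → e * δ m t ≡ 0
δ-off e m t = off (m ≟ₘ t)
  where
  off : (d : Dec (m ≡ t)) → m ≢ t → e * (if does d then 1 else 0) ≡ 0
  off (yes m≡t) m≢t = ⊥-elim (m≢t m≡t)
  off (no _) _ = *-zeroʳ e

δ-transfer : (g : Monomial → ℕ) (m t : Monomial) → g m * δ m t ≡ g t * δ m t
δ-transfer g m t = transfer (m ≟ₘ t)
  where
  transfer : (d : Dec (m ≡ t)) → g m * (if does d then 1 else 0) ≡ g t * (if does d then 1 else 0)
  transfer (yes refl) = refl
  transfer (no _) = trans (*-zeroʳ (g m)) (sym (*-zeroʳ (g t)))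

termCoeff : Monomial → ℕ × Monomial → ℕ
termCoeff t (k , m) = k * δ m t

coeff-∑ : ∀ p t → coeff p t ≡ ∑ (termCoeff t) p
coeff-∑ [] t = refl
coeff-∑ ((k , m) ∷ p) t = cong₂ _+_ (scaled (m ≟ₘ t)) (coeff-∑ p t)
  where
  scaled : (d : Dec (m ≡ t)) → (if does d then k else 0) ≡ k * (if does d then 1 else 0)
  scaled (yes _) = sym (*-identityʳ k)
  scaled (no _) = sym (*-zeroʳ k)

coeff-++ : ∀ p q t → coeff (p ++ q) t ≡ coeff p t + coeff q t
coeff-++ p q t = trans (coeff-∑ (p ++ q) t)
  (trans (∑-++ (termCoeff t) p q) (sym (cong₂ _+_ (coeff-∑ p t) (coeff-∑ q t))))

coeff-concatMap : {A : Set} (f : A → Poly) (xs : List A) (t : Monomial) →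
                  coeff (concatMap f xs) t ≡ ∑ (λ x → coeff (f x) t) xs
coeff-concatMap f [] t = refl
coeff-concatMap f (x ∷ xs) t =
  trans (coeff-++ (f x) (concatMap f xs) t) (cong (coeff (f x) t +_) (coeff-concatMap f xs t))

coeff-map : {A : Set} (f : A → ℕ × Monomial) (xs : List A) (t : Monomial) →
            coeff (map f xs) t ≡ ∑ (termCoeff t ∘ f) xs
coeff-map f xs t = trans (coeff-∑ (map f xs) t) (∑-map (termCoeff t) f xs)

-- The formal derivative: the Leibniz formula for the coefficients of D(p) and a
-- backward formula showing that they only depend on the coefficients of p.

-- The four rules of G, named after the variable they rewrite.
data Label : Set where
  Lx Ly Lz Lw : Label

allLabels : List Label
allLabels = Lx ∷ Ly ∷ Lz ∷ Lw ∷ []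

exponent : Label → Monomial → ℕ
exponent Lx (a , b , c , d) = a
exponent Ly (a , b , c , d) = b
exponent Lz (a , b , c , d) = c
exponent Lw (a , b , c , d) = d

applyRule : Label → Monomial → Monomial
applyRule Lx (a , b , c , d) = (a , suc b , c , d)
applyRule Ly (a , b , c , d) = (suc a , b ∸ 1 , suc c , d)
applyRule Lz (a , b , c , d) = (a , b , c , suc d)
applyRule Lw (a , b , c , d) = (suc a , b , suc c , d ∸ 1)

derivCoeff : Monomial → Monomial → ℕ
derivCoeff m t = ∑ (λ τ → exponent τ m * δ (applyRule τ m) t) allLabels

leibnizTerm : ℕ → Label → Monomial → Poly
leibnizTerm k Lx (suc a , b , c , d) = [ (k * suc a , (a , b , c , d) ·ₘ Gx) ]
leibnizTerm k Ly (a , suc b , c , d) = [ (k * suc b , (a , b , c , d) ·ₘ Gy) ]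
leibnizTerm k Lz (a , b , suc c , d) = [ (k * suc c , (a , b , c , d) ·ₘ Gz) ]
leibnizTerm k Lw (a , b , c , suc d) = [ (k * suc d , (a , b , c , d) ·ₘ Gw) ]
leibnizTerm k _ _ = []

Dₘ-leibniz : ∀ k m → Dₘ k m ≡ concatMap (λ τ → leibnizTerm k τ m) allLabels
Dₘ-leibniz k (zero , zero , zero , zero) = refl
Dₘ-leibniz k (zero , zero , zero , suc d) = refl
Dₘ-leibniz k (zero , zero , suc c , zero) = refl
Dₘ-leibniz k (zero , zero , suc c , suc d) = refl
Dₘ-leibniz k (zero , suc b , zero , zero) = refl
Dₘ-leibniz k (zero , suc b , zero , suc d) = refl
Dₘ-leibniz k (zero , suc b , suc c , zero) = refl
Dₘ-leibniz k (zero , suc b , suc c , suc d) = refl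
Dₘ-leibniz k (suc a , zero , zero , zero) = refl
Dₘ-leibniz k (suc a , zero , zero , suc d) = refl
Dₘ-leibniz k (suc a , zero , suc c , zero) = refl
Dₘ-leibniz k (suc a , zero , suc c , suc d) = refl
Dₘ-leibniz k (suc a , suc b , zero , zero) = refl
Dₘ-leibniz k (suc a , suc b , zero , suc d) = refl
Dₘ-leibniz k (suc a , suc b , suc c , zero) = refl
Dₘ-leibniz k (suc a , suc b , suc c , suc d) = refl

·ₘ-comm : ∀ m m′ → m ·ₘ m′ ≡ m′ ·ₘ m
·ₘ-comm (a , b , c , d) (a′ , b′ , c′ , d′)
  rewrite +-comm a a′ | +-comm b b′ | +-comm c c′ | +-comm d d′ = refl

coeff-single : ∀ k e m′ m t → m′ ≡ m → coeff [ (k * e , m′) ] t ≡ k * (e * δ m t)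
coeff-single k e m′ m t refl =
  trans (coeff-∑ [ (k * e , m) ] t) (trans (+-identityʳ _) (*-assoc k e (δ m t)))

-- Coefficients of the Leibniz terms; since G ·ₘ m′ computes definitionally,
-- commuting the product exposes applyRule.
coeff-leibnizTerm : ∀ k τ m t → coeff (leibnizTerm k τ m) t ≡ k * (exponent τ m * δ (applyRule τ m) t)
coeff-leibnizTerm k Lx (suc a , b , c , d) t = coeff-single k (suc a) _ _ t (·ₘ-comm (a , b , c , d) Gx)
coeff-leibnizTerm k Lx (zero , b , c , d) t = sym (*-zeroʳ k)
coeff-leibnizTerm k Ly (a , suc b , c , d) t = coeff-single k (suc b) _ _ t (·ₘ-comm (a , b , c , d) Gy)
coeff-leibnizTerm k Ly (a , zero , c , d) t = sym (*-zeroʳ k)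
coeff-leibnizTerm k Lz (a , b , suc c , d) t = coeff-single k (suc c) _ _ t (·ₘ-comm (a , b , c , d) Gz)
coeff-leibnizTerm k Lz (a , b , zero , d) t = sym (*-zeroʳ k)
coeff-leibnizTerm k Lw (a , b , c , suc d) t = coeff-single k (suc d) _ _ t (·ₘ-comm (a , b , c , d) Gw)
coeff-leibnizTerm k Lw (a , b , c , zero) t = sym (*-zeroʳ k)

coeff-Dₘ : ∀ k m t → coeff (Dₘ k m) t ≡ k * derivCoeff m t
coeff-Dₘ k m t = begin
  coeff (Dₘ k m) t
    ≡⟨ cong (λ p → coeff p t) (Dₘ-leibniz k m) ⟩
  coeff (concatMap (λ τ → leibnizTerm k τ m) allLabels) t
    ≡⟨ coeff-concatMap (λ τ → leibnizTerm k τ m) allLabels t ⟩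
  ∑ (λ τ → coeff (leibnizTerm k τ m) t) allLabels
    ≡⟨ ∑-cong allLabels (λ {τ} _ → coeff-leibnizTerm k τ m t) ⟩
  ∑ (λ τ → k * (exponent τ m * δ (applyRule τ m) t)) allLabels
    ≡⟨ sym (∑-*ˡ k (λ τ → exponent τ m * δ (applyRule τ m) t) allLabels) ⟩
  k * derivCoeff m t ∎
  where open ≡-Reasoning

derivTerm : Monomial → ℕ × Monomial → ℕ
derivTerm t (k , m) = k * derivCoeff m t

coeff-D : ∀ p t → coeff (D p) t ≡ ∑ (derivTerm t) p
coeff-D [] t = refl
coeff-D ((k , m) ∷ p) t = trans (coeff-++ (Dₘ k m) (D p) t) (cong₂ _+_ (coeff-Dₘ k m t) (coeff-D p t))

-- The monomials from which the rule τ produces t, each paired with the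
-- exponent by which the Leibniz rule weighs it.
sources : Label → Monomial → List (ℕ × Monomial)
sources Lx (A , suc B , C , D) = [ (A , (A , B , C , D)) ]
sources Ly (suc A , B , suc C , D) = [ (suc B , (A , suc B , C , D)) ]
sources Lz (A , B , C , suc D) = [ (C , (A , B , C , D)) ]
sources Lw (suc A , B , suc C , D) = [ (suc D , (A , B , C , suc D)) ]
sources _ _ = []

allSources : Monomial → List (ℕ × Monomial)
allSources t = concatMap (λ τ → sources τ t) allLabels

weighted : (Monomial → ℕ) → ℕ × Monomial → ℕ
weighted f (e , s) = e * f s

rule-sources : ∀ τ m t → exponent τ m * δ (applyRule τ m) t ≡ ∑ (weighted (δ m)) (sources τ t)
rule-sources Lx (a , b , c , d) t@(A , zero , C , D) = δ-off a (a , suc b , c , d) t (λ ())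
rule-sources Lx (a , b , c , d) (A , suc B , C , D) =
  trans (δ-transfer proj₁ (a , b , c , d) (A , B , C , D)) (sym (+-identityʳ _))
rule-sources Ly m@(a , zero , c , d) (suc A , B , suc C , D) =
  sym (trans (+-identityʳ _) (δ-off (suc B) m (A , suc B , C , D) (λ ())))
rule-sources Ly (a , suc b , c , d) (suc A , B , suc C , D) =
  trans (δ-transfer (suc ∘ proj₁ ∘ proj₂) (a , b , c , d) (A , B , C , D)) (sym (+-identityʳ _))
rule-sources Ly m@(a , b , c , d) t@(zero , B , C , D) = δ-off b (applyRule Ly m) t (λ ())
rule-sources Ly m@(a , b , c , d) t@(suc A , B , zero , D) = δ-off b (applyRule Ly m) t (λ ())
rule-sources Lz m@(a , b , c , d) t@(A , B , C , zero) = δ-off c (applyRule Lz m) t (λ ())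
rule-sources Lz (a , b , c , d) (A , B , C , suc D) =
  trans (δ-transfer (proj₁ ∘ proj₂ ∘ proj₂) (a , b , c , d) (A , B , C , D)) (sym (+-identityʳ _))
rule-sources Lw m@(a , b , c , zero) (suc A , B , suc C , D) =
  sym (trans (+-identityʳ _) (δ-off (suc D) m (A , B , C , suc D) (λ ())))
rule-sources Lw (a , b , c , suc d) (suc A , B , suc C , D) =
  trans (δ-transfer (suc ∘ proj₂ ∘ proj₂ ∘ proj₂) (a , b , c , d) (A , B , C , D)) (sym (+-identityʳ _))
rule-sources Lw m@(a , b , c , d) t@(zero , B , C , D) = δ-off d (applyRule Lw m) t (λ ())
rule-sources Lw m@(a , b , c , d) t@(suc A , B , zero , D) = δ-off d (applyRule Lw m) t (λ ())

derivCoeff-sources : ∀ m t → derivCoeff m t ≡ ∑ (weighted (δ m)) (allSources t)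
derivCoeff-sources m t = trans (∑-cong allLabels (λ {τ} _ → rule-sources τ m t))
                               (sym (∑-concatMap (weighted (δ m)) (λ τ → sources τ t) allLabels))

coeff-D-sources : ∀ p t → coeff (D p) t ≡ ∑ (weighted (coeff p)) (allSources t)
coeff-D-sources p t = begin
  coeff (D p) t
    ≡⟨ coeff-D p t ⟩
  ∑ (derivTerm t) p
    ≡⟨ ∑-cong p (λ {(k , m)} _ → cong (k *_) (derivCoeff-sources m t)) ⟩
  ∑ (λ (km : ℕ × Monomial) → proj₁ km * ∑ (weighted (δ (proj₂ km))) (allSources t)) p
    ≡⟨ ∑-exchange proj₁ proj₁ (λ km es → δ (proj₂ km) (proj₂ es)) p (allSources t) ⟩
  ∑ (λ (es : ℕ × Monomial) → proj₁ es * ∑ (termCoeff (proj₂ es)) p) (allSources t)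
    ≡⟨ ∑-cong (allSources t) (λ {(e , s)} _ → cong (e *_) (sym (coeff-∑ p s))) ⟩
  ∑ (weighted (coeff p)) (allSources t) ∎
  where open ≡-Reasoning

D-resp : ∀ p q → (∀ s → coeff p s ≡ coeff q s) → ∀ t → coeff (D p) t ≡ coeff (D q) t
D-resp p q p≈q t = begin
  coeff (D p) t                          ≡⟨ coeff-D-sources p t ⟩
  ∑ (weighted (coeff p)) (allSources t)  ≡⟨ ∑-cong (allSources t) (λ {(e , s)} _ → cong (e *_) (p≈q s)) ⟩
  ∑ (weighted (coeff q)) (allSources t)  ≡⟨ sym (coeff-D-sources q t) ⟩
  coeff (D q) t                          ∎
  where open ≡-Reasoning

-- Q_n as a sum of one monomial per permutation.

qMono : ℕ → ℕ → ℕ → Monomial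
qMono n i j = (i , j , i , suc n ∸ (2 * i + j))

weight : ℕ → List ℕ → Monomial
weight n σ = qMono n (pk σ) (dd σ)

∑-pick : ∀ (g : ℕ → ℕ) {i} (xs : List ℕ) → Unique xs → i ∈ xs → ∑ (λ j → χ (i ≟ j) * g j) xs ≡ g i
∑-pick g {i} (y ∷ ys) (i∉ys ∷ u) i∈ with i ≟ y | i∈
... | yes refl | _ = trans (cong (_+ ∑ (λ j → χ (i ≟ j) * g j) ys) (*-identityˡ (g i)))
                           (trans (cong (g i +_) absent) (+-identityʳ (g i)))
  where
  absent : ∑ (λ j → χ (i ≟ j) * g j) ys ≡ 0
  absent = trans (∑-cong ys (λ {j} j∈ → off (i ≟ j) (All.lookup i∉ys j∈))) (∑-zero ys)
    where
    off : ∀ {j} (d : Dec (i ≡ j)) → i ≢ j → χ d * g j ≡ 0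
    off (yes i≡j) i≢j = ⊥-elim (i≢j i≡j)
    off (no _) _ = refl
... | no i≢y | here i≡y = ⊥-elim (i≢y i≡y)
... | no _ | there i∈ys = ∑-pick g ys u i∈ys

zeroTo-unique : ∀ n → Unique (zeroTo n)
zeroTo-unique n = ¬Any⇒All¬ _ (λ 0∈ → zero-not-letter (∈-oneTo⁻ 0∈)) ∷ oneTo-unique n
  where
  zero-not-letter : ¬ Letter n 0
  zero-not-letter ()

∈-zeroTo : ∀ {n i} → i ≤ n → i ∈ zeroTo n
∈-zeroTo {i = zero} _ = here refl
∈-zeroTo {i = suc i} i≤n = there (∈-oneTo⁺ (s≤s z≤n , i≤n))

triples-≤ : ∀ P a b l → countTriples P (a ∷ b ∷ l) ≤ length l
triples-≤ P a b [] = z≤n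
triples-≤ P a b (c ∷ l) with P a b c
... | true = s≤s (triples-≤ P b c l)
... | false = m≤n⇒m≤1+n (triples-≤ P b c l)

padded-triples-≤ : ∀ P σ → countTriples P (padded σ) ≤ length σ
padded-triples-≤ P [] = z≤n
padded-triples-≤ P (x ∷ σ) =
  subst (countTriples P (padded (x ∷ σ)) ≤_) (trans (length-++ σ) (+-comm (length σ) 1)) (triples-≤ P 0 x (σ ++ [ 0 ]))

pick-weight : ∀ n t σ → length σ ≡ n →
  ∑ (λ i → ∑ (λ j → (χ (dd σ ≟ j) * χ (pk σ ≟ i)) * δ (qMono n i j) t) (zeroTo n)) (zeroTo n) ≡ δ (weight n σ) t
pick-weight n t σ len = begin
  ∑ (λ i → ∑ (λ j → (χ (dd σ ≟ j) * χ (pk σ ≟ i)) * δ (qMono n i j) t) Z) Z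
    ≡⟨ ∑-cong Z (λ {i} _ → trans (∑-cong Z (λ {j} _ → regroup (χ (dd σ ≟ j)) (χ (pk σ ≟ i)) _))
                                  (sym (∑-*ˡ (χ (pk σ ≟ i)) (λ j → χ (dd σ ≟ j) * δ (qMono n i j) t) Z))) ⟩
  ∑ (λ i → χ (pk σ ≟ i) * ∑ (λ j → χ (dd σ ≟ j) * δ (qMono n i j) t) Z) Z
    ≡⟨ ∑-pick (λ i → ∑ (λ j → χ (dd σ ≟ j) * δ (qMono n i j) t) Z) Z (zeroTo-unique n) (bounded isPeak) ⟩
  ∑ (λ j → χ (dd σ ≟ j) * δ (qMono n (pk σ) j) t) Z
    ≡⟨ ∑-pick (λ j → δ (qMono n (pk σ) j) t) Z (zeroTo-unique n) (bounded isDD) ⟩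
  δ (weight n σ) t ∎
  where
  open ≡-Reasoning
  Z = zeroTo n
  regroup : ∀ a b c → (a * b) * c ≡ b * (a * c)
  regroup a b c = trans (cong (_* c) (*-comm a b)) (*-assoc b a c)
  bounded : ∀ P → countTriples P (padded σ) ∈ Z
  bounded P = ∈-zeroTo (subst (countTriples P (padded σ) ≤_) len (padded-triples-≤ P σ))

coeff-Qpoly : ∀ n t → coeff (Qpoly n) t ≡ ∑ (λ σ → δ (weight n σ) t) (perms n)
coeff-Qpoly n t = begin
  coeff (Qpoly n) t
    ≡⟨ coeff-concatMap (λ i → map (λ j → (Qcount n i j , qMono n i j)) Z) Z t ⟩
  ∑ (λ i → coeff (map (λ j → (Qcount n i j , qMono n i j)) Z) t) Z
    ≡⟨ ∑-cong Z (λ {i} _ → coeff-map (λ j → (Qcount n i j , qMono n i j)) Z t) ⟩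
  ∑ (λ i → ∑ (λ j → Qcount n i j * δ (qMono n i j) t) Z) Z
    ≡⟨ ∑-cong Z (λ {i} _ → ∑-cong Z (λ {j} _ → trans (cong (_* δ (qMono n i j) t) (count i j))
                                                       (∑-*ʳ (hit i j) (perms n) (δ (qMono n i j) t)))) ⟩
  ∑ (λ i → ∑ (λ j → ∑ (λ σ → hit i j σ * δ (qMono n i j) t) (perms n)) Z) Z
    ≡⟨ ∑-cong Z (λ {i} _ → ∑-swap (λ j σ → hit i j σ * δ (qMono n i j) t) Z (perms n)) ⟩
  ∑ (λ i → ∑ (λ σ → ∑ (λ j → hit i j σ * δ (qMono n i j) t) Z) (perms n)) Z
    ≡⟨ ∑-swap (λ i σ → ∑ (λ j → hit i j σ * δ (qMono n i j) t) Z) Z (perms n) ⟩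
  ∑ (λ σ → ∑ (λ i → ∑ (λ j → hit i j σ * δ (qMono n i j) t) Z) Z) (perms n)
    ≡⟨ ∑-cong (perms n) (λ {σ} σ∈ → pick-weight n t σ (length≡ (∈-perms⁻ σ∈))) ⟩
  ∑ (λ σ → δ (weight n σ) t) (perms n) ∎
  where
  open ≡-Reasoning
  Z = zeroTo n
  hit : ℕ → ℕ → List ℕ → ℕ
  hit i j σ = χ (dd σ ≟ j) * χ (pk σ ≟ i)
  count : ∀ i j → Qcount n i j ≡ ∑ (hit i j) (perms n)
  count i j = length-filter² (λ σ → pk σ ≟ i) (λ σ → dd σ ≟ j) (perms n)

-- The grammatical labeling: each gap of a padded word gets the rule of G that
-- inserting a new maximum into it applies to the weight.

<ᵇ-true : ∀ {m n} → m < n → (m <ᵇ n) ≡ true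
<ᵇ-true {m} {n} m<n with m <ᵇ n | <⇒<ᵇ m<n
... | true | _ = refl

<ᵇ-false : ∀ {m n} → n ≤ m → (m <ᵇ n) ≡ false
<ᵇ-false {m} {n} n≤m with m <ᵇ n in eq
... | false = refl
... | true = ⊥-elim (<⇒≱ (<ᵇ⇒< m n (subst T (sym eq) tt)) n≤m)

-- Peaks and double descents of a word, counted over all its letters but the ends.
peaks ddescents : List ℕ → ℕ
peaks = countTriples isPeak
ddescents = countTriples isDD

ind : Bool → ℕ
ind x = if x then 1 else 0

stats : List ℕ → ℕ × ℕ
stats w = (peaks w , ddescents w)

-- An ascent b < c is labelled x when c is a peak and w
-- otherwise; a descent b > c is labelled z when b is a peak and y when b is a
-- double descent.
ascentLabel : ℕ → List ℕ → Label
ascentLabel c (e ∷ _) = if e <ᵇ c then Lx else Lw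
ascentLabel c [] = Lw

gapLabel : ℕ → ℕ → ℕ → List ℕ → Label
gapLabel a b c t = if b <ᵇ c then ascentLabel c t else (if a <ᵇ b then Lz else Ly)

gapLabels : ℕ → List ℕ → List Label
gapLabels a (b ∷ c ∷ t) = gapLabel a b c t ∷ gapLabels b (c ∷ t)
gapLabels a _ = []

Shifted : Label → ℕ × ℕ → ℕ × ℕ → Set
Shifted Lx (p , d) (p′ , d′) = p′ ≡ p × d′ ≡ suc d
Shifted Ly (p , d) (p′ , d′) = p′ ≡ suc p × suc d′ ≡ d
Shifted Lz (p , d) (p′ , d′) = p′ ≡ p × d′ ≡ d
Shifted Lw (p , d) (p′ , d′) = p′ ≡ suc p × d′ ≡ d

gap-shift : ∀ {M} a b c t → b < M → c < M → a ≢ b → b ≢ c →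
  Shifted (gapLabel a b c t) (stats (a ∷ b ∷ c ∷ t)) (stats (a ∷ b ∷ M ∷ c ∷ t))
gap-shift a b c [] b<M c<M a≢b b≢c
  rewrite <ᵇ-true b<M | <ᵇ-true c<M | <ᵇ-false (<⇒≤ b<M) | ∧-zeroʳ (a <ᵇ b) | ∧-zeroʳ (b <ᵇ a)
  with <-cmp b c
... | tri≈ _ b≡c _ = ⊥-elim (b≢c b≡c)
... | tri< b<c _ _ rewrite <ᵇ-true b<c | <ᵇ-false (<⇒≤ b<c) | ∧-zeroʳ (a <ᵇ b) | ∧-zeroʳ (b <ᵇ a) = refl , refl
... | tri> _ _ c<b rewrite <ᵇ-false (<⇒≤ c<b) | <ᵇ-true c<b | ∧-identityʳ (a <ᵇ b) | ∧-identityʳ (b <ᵇ a)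
  with <-cmp a b
...   | tri< a<b _ _ rewrite <ᵇ-true a<b | <ᵇ-false (<⇒≤ a<b) = refl , refl
...   | tri≈ _ a≡b _ = ⊥-elim (a≢b a≡b)
...   | tri> _ _ b<a rewrite <ᵇ-false (<⇒≤ b<a) | <ᵇ-true b<a = refl , refl
gap-shift a b c (e ∷ t) b<M c<M a≢b b≢c
  rewrite <ᵇ-true b<M | <ᵇ-true c<M | <ᵇ-false (<⇒≤ b<M) | <ᵇ-false (<⇒≤ c<M) | ∧-zeroʳ (a <ᵇ b) | ∧-zeroʳ (b <ᵇ a)
  with <-cmp b c
... | tri≈ _ b≡c _ = ⊥-elim (b≢c b≡c)
... | tri< b<c _ _ rewrite <ᵇ-true b<c | <ᵇ-false (<⇒≤ b<c) | ∧-zeroʳ (a <ᵇ b) | ∧-zeroʳ (b <ᵇ a)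
  with e <ᵇ c
...   | true = refl , refl
...   | false = refl , refl
gap-shift a b c (e ∷ t) b<M c<M a≢b b≢c | tri> _ _ c<b
  rewrite <ᵇ-false (<⇒≤ c<b) | <ᵇ-true c<b | ∧-identityʳ (a <ᵇ b) | ∧-identityʳ (b <ᵇ a)
  with <-cmp a b
...   | tri< a<b _ _ rewrite <ᵇ-true a<b | <ᵇ-false (<⇒≤ a<b) = refl , refl
...   | tri≈ _ a≡b _ = ⊥-elim (a≢b a≡b)
...   | tri> _ _ b<a rewrite <ᵇ-false (<⇒≤ b<a) | <ᵇ-true b<a = refl , refl

-- Prepending letters adds the same contributions before and after the insertion.
Shifted-prefix : ∀ τ i j {p d p′ d′} → Shifted τ (p , d) (p′ , d′) → Shifted τ (i + p , j + d) (i + p′ , j + d′)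
Shifted-prefix Lx i j {d = d} (refl , refl) = refl , +-suc j d
Shifted-prefix Ly i j {p} {d′ = d′} (refl , refl) = +-suc i p , sym (+-suc j d′)
Shifted-prefix Lz i j (refl , refl) = refl , refl
Shifted-prefix Lw i j {p} (refl , refl) = +-suc i p , refl

Pointwise-mapʳ : {A B : Set} {R : A → B → Set} (g : B → B) {xs : List A} {ys : List B} →
                 Pointwise (λ x y → R x (g y)) xs ys → Pointwise R xs (map g ys)
Pointwise-mapʳ g [] = []
Pointwise-mapʳ g (r ∷ rs) = r ∷ Pointwise-mapʳ g rs

insertions-shift : ∀ {M} a b π → All (_< M) (b ∷ π ++ [ 0 ]) → Linked _≢_ (a ∷ b ∷ π ++ [ 0 ]) →
  Pointwise (λ τ σ → Shifted τ (stats (a ∷ b ∷ π ++ [ 0 ])) (stats (a ∷ b ∷ σ ++ [ 0 ])))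
            (gapLabels a (b ∷ π ++ [ 0 ])) (insertions M π)
insertions-shift a b [] (b<M ∷ 0<M ∷ []) (a≢b ∷ b≢0 ∷ [-]) = gap-shift a b 0 [] b<M 0<M a≢b b≢0 ∷ []
insertions-shift a b (x ∷ π) (b<M ∷ bounds@(x<M ∷ _)) (a≢b ∷ linked@(b≢x ∷ _)) =
  gap-shift a b x (π ++ [ 0 ]) b<M x<M a≢b b≢x ∷
  Pointwise-mapʳ (x ∷_) (Pointwise.map (Shifted-prefix _ _ _) (insertions-shift b x π bounds linked))

isLabel : Label → Label → ℕ
isLabel Lx Lx = 1
isLabel Ly Ly = 1
isLabel Lz Lz = 1
isLabel Lw Lw = 1
isLabel _ _ = 0

count : Label → List Label → ℕ
count τ = ∑ (isLabel τ)

∑-byLabel : ∀ (h : Label → ℕ) τs → ∑ h τs ≡ ∑ (λ τ → count τ τs * h τ) allLabels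
∑-byLabel h [] = refl
∑-byLabel h (τ′ ∷ τs) = begin
  h τ′ + ∑ h τs
    ≡⟨ cong₂ _+_ (sym (pick τ′)) (∑-byLabel h τs) ⟩
  ∑ (λ τ → isLabel τ τ′ * h τ) allLabels + ∑ (λ τ → count τ τs * h τ) allLabels
    ≡⟨ sym (∑-+ (λ τ → isLabel τ τ′ * h τ) (λ τ → count τ τs * h τ) allLabels) ⟩
  ∑ (λ τ → isLabel τ τ′ * h τ + count τ τs * h τ) allLabels
    ≡⟨ ∑-cong allLabels (λ {τ} _ → sym (*-distribʳ-+ (h τ) (isLabel τ τ′) (count τ τs))) ⟩
  ∑ (λ τ → count τ (τ′ ∷ τs) * h τ) allLabels ∎
  where
  open ≡-Reasoning
  pick : ∀ τ′ → ∑ (λ τ → isLabel τ τ′ * h τ) allLabels ≡ h τ′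
  pick Lx = trans (+-identityʳ _) (*-identityˡ (h Lx))
  pick Ly = trans (+-identityʳ _) (*-identityˡ (h Ly))
  pick Lz = trans (+-identityʳ _) (*-identityˡ (h Lz))
  pick Lw = trans (+-identityʳ _) (*-identityˡ (h Lw))

count-x : ∀ a b t → count Lx (gapLabels a (b ∷ t)) ≡ peaks (b ∷ t)
count-x a b [] = refl
count-x a b (c ∷ []) = x-last
  where
  x-last : isLabel Lx (gapLabel a b c []) + 0 ≡ 0
  x-last with b <ᵇ c | a <ᵇ b
  ... | true | _ = refl
  ... | false | true = refl
  ... | false | false = refl
count-x a b (c ∷ e ∷ t) = cong₂ _+_ x-gap (count-x b c (e ∷ t))
  where
  x-gap : isLabel Lx (gapLabel a b c (e ∷ t)) ≡ ind (isPeak b c e)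
  x-gap with b <ᵇ c | e <ᵇ c | a <ᵇ b
  ... | true | true | _ = refl
  ... | true | false | _ = refl
  ... | false | _ | true = refl
  ... | false | _ | false = refl

ascent-not-z : ∀ c t → isLabel Lz (ascentLabel c t) ≡ 0
ascent-not-z c [] = refl
ascent-not-z c (e ∷ _) with e <ᵇ c
... | true = refl
... | false = refl

ascent-not-y : ∀ c t → isLabel Ly (ascentLabel c t) ≡ 0
ascent-not-y c [] = refl
ascent-not-y c (e ∷ _) with e <ᵇ c
... | true = refl
... | false = refl

count-z : ∀ a b t → Linked _≢_ (b ∷ t) → count Lz (gapLabels a (b ∷ t)) ≡ peaks (a ∷ b ∷ t)
count-z a b [] _ = refl
count-z a b (c ∷ t) (b≢c ∷ linked) = cong₂ _+_ z-gap (count-z b c t linked)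
  where
  z-gap : isLabel Lz (gapLabel a b c t) ≡ ind (isPeak a b c)
  z-gap with <-cmp b c
  ... | tri< b<c _ _ rewrite <ᵇ-true b<c | <ᵇ-false (<⇒≤ b<c) | ∧-zeroʳ (a <ᵇ b) = ascent-not-z c t
  ... | tri≈ _ b≡c _ = ⊥-elim (b≢c b≡c)
  ... | tri> _ _ c<b rewrite <ᵇ-false (<⇒≤ c<b) | <ᵇ-true c<b | ∧-identityʳ (a <ᵇ b) with a <ᵇ b
  ...   | true = refl
  ...   | false = refl

count-y : ∀ a b t → Linked _≢_ (a ∷ b ∷ t) → count Ly (gapLabels a (b ∷ t)) ≡ ddescents (a ∷ b ∷ t)
count-y a b [] _ = refl
count-y a b (c ∷ t) (a≢b ∷ linked@(b≢c ∷ _)) = cong₂ _+_ y-gap (count-y b c t linked)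
  where
  y-gap : isLabel Ly (gapLabel a b c t) ≡ ind (isDD a b c)
  y-gap with <-cmp b c
  ... | tri< b<c _ _ rewrite <ᵇ-true b<c | <ᵇ-false (<⇒≤ b<c) | ∧-zeroʳ (b <ᵇ a) = ascent-not-y c t
  ... | tri≈ _ b≡c _ = ⊥-elim (b≢c b≡c)
  ... | tri> _ _ c<b rewrite <ᵇ-false (<⇒≤ c<b) | <ᵇ-true c<b | ∧-identityʳ (b <ᵇ a) with <-cmp a b
  ...   | tri< a<b _ _ rewrite <ᵇ-true a<b | <ᵇ-false (<⇒≤ a<b) = refl
  ...   | tri≈ _ a≡b _ = ⊥-elim (a≢b a≡b)
  ...   | tri> _ _ b<a rewrite <ᵇ-false (<⇒≤ b<a) | <ᵇ-true b<a = refl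

length-gapLabels : ∀ a b t → length (gapLabels a (b ∷ t)) ≡ length t
length-gapLabels a b [] = refl
length-gapLabels a b (c ∷ t) = cong suc (length-gapLabels b c t)

-- The padded word 0 π 0 is read with the extra left neighbour 1, which creates
-- no peak or double descent (stats-frame) and keeps adjacent letters distinct.
paddedLabels : List ℕ → List Label
paddedLabels π = gapLabels 1 (padded π)

stats-frame : ∀ l → stats (1 ∷ 0 ∷ l) ≡ stats (0 ∷ l)
stats-frame [] = refl
stats-frame (c ∷ l) = refl

padded-bounded : ∀ {N π} → IsPerm N π → All (_< suc N) (padded π)
padded-bounded isp = s≤s z≤n ∷ All-++⁺ (All.map (λ (_ , x≤N) → s≤s x≤N) (letters isp)) (s≤s z≤n ∷ [])

padded-linked : ∀ {N x π} → IsPerm N (x ∷ π) → Linked _≢_ (1 ∷ padded (x ∷ π))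
padded-linked {x = x} {π} isp = (λ ()) ∷ 0≢x ∷ AllPairs⇒Linked (Unique.++⁺ (distinct isp) ([] ∷ []) 0∉)
  where
  positive : ∀ {y} → y ∈ x ∷ π → y ≢ 0
  positive y∈ refl with All.lookup (letters isp) y∈
  ... | () , _
  0≢x : 0 ≢ x
  0≢x 0≡x = positive (here refl) (sym 0≡x)
  0∉ : Disjoint (x ∷ π) [ 0 ]
  0∉ (y∈ , here y≡0) = positive y∈ y≡0

double-suc : ∀ p → 2 * suc p ≡ suc (suc (2 * p))
double-suc p = cong suc (+-suc p (p + 0))

shifted-weight : ∀ N τ {p d p′ d′} → 2 * p + d ≤ suc N → Shifted τ (p , d) (p′ , d′) →
                 qMono (suc N) p′ d′ ≡ applyRule τ (qMono N p d)
shifted-weight N Lx {p} {d} _ (refl , refl) =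
  cong (λ r → (p , suc d , p , r)) (cong (suc (suc N) ∸_) (+-suc (2 * p) d))
shifted-weight N Ly {p} {d′ = d′} _ (refl , refl) =
  cong (λ r → (suc p , d′ , suc p , r))
       (cong (suc (suc N) ∸_) (trans (cong (_+ d′) (double-suc p)) (cong suc (sym (+-suc (2 * p) d′)))))
shifted-weight N Lz {p} {d} bound (refl , refl) =
  cong (λ r → (p , d , p , r)) (+-∸-assoc 1 bound)
shifted-weight N Lw {p} {d} _ (refl , refl) =
  cong (λ r → (suc p , d , suc p , r))
       (trans (cong (suc (suc N) ∸_) (cong (_+ d) (double-suc p)))
              (sym (trans (∸-+-assoc (suc N) (2 * p + d) 1) (cong (suc N ∸_) (+-comm (2 * p + d) 1)))))

count-xyz : ∀ {N x π} → IsPerm N (x ∷ π) →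
  count Lx (paddedLabels (x ∷ π)) ≡ pk (x ∷ π) × count Ly (paddedLabels (x ∷ π)) ≡ dd (x ∷ π) ×
  count Lz (paddedLabels (x ∷ π)) ≡ pk (x ∷ π)
count-xyz {x = x} {π} isp with padded-linked isp
... | linked@(_ ∷ linked′) =
  count-x 1 0 (x ∷ π ++ [ 0 ]) , count-y 1 0 (x ∷ π ++ [ 0 ]) linked , count-z 1 0 (x ∷ π ++ [ 0 ]) linked′

labels-total : ∀ {N x π} → IsPerm N (x ∷ π) →
  (2 * pk (x ∷ π) + dd (x ∷ π)) + count Lw (paddedLabels (x ∷ π)) ≡ suc N
labels-total {N} {x} {π} isp with count-xyz isp
... | cx , cy , cz = begin
  (2 * p + d) + count Lw ls                                        ≡⟨ regroup p d (count Lw ls) ⟩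
  p * 1 + (d * 1 + (p * 1 + (count Lw ls * 1 + 0)))               ≡⟨ sym (substitute cx cy cz) ⟩
  ∑ (λ τ → count τ ls * 1) allLabels                               ≡⟨ sym (∑-byLabel (λ _ → 1) ls) ⟩
  ∑ (λ _ → 1) ls                                                   ≡⟨ ∑-const1 ls ⟩
  length ls                                                        ≡⟨ length-gapLabels 1 0 (x ∷ π ++ [ 0 ]) ⟩
  length ((x ∷ π) ++ [ 0 ])                                        ≡⟨ length-++ (x ∷ π) ⟩
  length (x ∷ π) + 1                                               ≡⟨ +-comm (length (x ∷ π)) 1 ⟩
  suc (length (x ∷ π))                                             ≡⟨ cong suc (length≡ isp) ⟩
  suc N                                                            ∎
  where
  open ≡-Reasoning
  ls = paddedLabels (x ∷ π)
  p = pk (x ∷ π)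
  d = dd (x ∷ π)
  regroup : ∀ p d w → (2 * p + d) + w ≡ p * 1 + (d * 1 + (p * 1 + (w * 1 + 0)))
  regroup = solve 3 (λ p d w → (con 2 :* p :+ d) :+ w
                              := p :* con 1 :+ (d :* con 1 :+ (p :* con 1 :+ (w :* con 1 :+ con 0)))) refl
  substitute : ∀ {a a′ b b′ c c′ e} → a ≡ a′ → b ≡ b′ → c ≡ c′ →
               a * 1 + (b * 1 + (c * 1 + e)) ≡ a′ * 1 + (b′ * 1 + (c′ * 1 + e))
  substitute refl refl refl = refl

-- Hence 2·pk + dd ≤ n + 1, so the exponent of w in the weight is a true difference.
label-bound : ∀ {N x π} → IsPerm N (x ∷ π) → 2 * pk (x ∷ π) + dd (x ∷ π) ≤ suc N
label-bound {x = x} {π} isp = subst (2 * pk (x ∷ π) + dd (x ∷ π) ≤_) (labels-total isp) (m≤m+n _ _)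

label-counts : ∀ {N x π} → IsPerm N (x ∷ π) → ∀ τ → count τ (paddedLabels (x ∷ π)) ≡ exponent τ (weight N (x ∷ π))
label-counts isp Lx = proj₁ (count-xyz isp)
label-counts isp Ly = proj₁ (proj₂ (count-xyz isp))
label-counts isp Lz = proj₂ (proj₂ (count-xyz isp))
label-counts {N} {x} {π} isp Lw =
  trans (sym (m+n∸m≡n (2 * pk (x ∷ π) + dd (x ∷ π)) _)) (cong (_∸ (2 * pk (x ∷ π) + dd (x ∷ π))) (labels-total isp))

insertion-sum : ∀ {N x π} → IsPerm N (x ∷ π) → ∀ t →
  ∑ (λ σ → δ (weight (suc N) σ) t) (insertions (suc N) (x ∷ π)) ≡ derivCoeff (weight N (x ∷ π)) t
insertion-sum {N} {x} {π} isp t = begin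
  ∑ (λ σ → δ (weight (suc N) σ) t) (insertions (suc N) (x ∷ π))
    ≡⟨ sym (∑-Pointwise (λ τ → δ (applyRule τ w) t) (λ σ → δ (weight (suc N) σ) t) rule
                        (insertions-shift 1 0 (x ∷ π) (padded-bounded isp) (padded-linked isp))) ⟩
  ∑ (λ τ → δ (applyRule τ w) t) (paddedLabels (x ∷ π))
    ≡⟨ ∑-byLabel (λ τ → δ (applyRule τ w) t) (paddedLabels (x ∷ π)) ⟩
  ∑ (λ τ → count τ (paddedLabels (x ∷ π)) * δ (applyRule τ w) t) allLabels
    ≡⟨ ∑-cong allLabels (λ {τ} _ → cong (_* δ (applyRule τ w) t) (label-counts isp τ)) ⟩
  derivCoeff w t ∎
  where
  open ≡-Reasoning
  w = weight N (x ∷ π)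
  rule : ∀ τ σ → Shifted τ (stats (1 ∷ padded (x ∷ π))) (stats (1 ∷ 0 ∷ σ ++ [ 0 ])) →
         δ (applyRule τ w) t ≡ δ (weight (suc N) σ) t
  rule τ σ shifted = cong (λ m → δ m t) (sym (shifted-weight N τ (label-bound isp)
                           (subst (Shifted τ (pk (x ∷ π) , dd (x ∷ π))) (stats-frame (σ ++ [ 0 ])) shifted)))

permPoly : ℕ → Poly
permPoly n = map (λ σ → (1 , weight n σ)) (perms n)

coeff-permPoly : ∀ n t → coeff (permPoly n) t ≡ ∑ (λ σ → δ (weight n σ) t) (perms n)
coeff-permPoly n t = trans (coeff-map (λ σ → (1 , weight n σ)) (perms n) t)
                           (∑-cong (perms n) (λ {σ} _ → *-identityˡ (δ (weight n σ) t)))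

D-permPoly : ∀ n t → coeff (D (permPoly (suc n))) t ≡ coeff (permPoly (suc (suc n))) t
D-permPoly n t = begin
  coeff (D (permPoly N)) t
    ≡⟨ coeff-D (permPoly N) t ⟩
  ∑ (derivTerm t) (permPoly N)
    ≡⟨ ∑-map (derivTerm t) (λ σ → (1 , weight N σ)) (perms N) ⟩
  ∑ (λ σ → 1 * derivCoeff (weight N σ) t) (perms N)
    ≡⟨ ∑-cong (perms N) (λ {σ} σ∈ → trans (*-identityˡ _) (sym (insert σ (∈-perms⁻ σ∈)))) ⟩
  ∑ (λ σ → ∑ f (insertions M σ)) (perms N)
    ≡⟨ sym (∑-concatMap f (insertions M) (perms N)) ⟩
  ∑ f (concatMap (insertions M) (perms N))
    ≡⟨ sym (∑-↭ f (perms-suc N)) ⟩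
  ∑ f (perms M)
    ≡⟨ sym (coeff-permPoly M t) ⟩
  coeff (permPoly M) t ∎
  where
  open ≡-Reasoning
  N = suc n
  M = suc N
  f : List ℕ → ℕ
  f σ = δ (weight M σ) t
  insert : ∀ σ → IsPerm N σ → ∑ f (insertions M σ) ≡ derivCoeff (weight N σ) t
  insert [] isp = ⊥-elim (0≢1+n (length≡ isp))
  insert (x ∷ π) isp = insertion-sum isp t

D^-polyY : ∀ n t → coeff (D^ (suc n) polyY) t ≡ coeff (permPoly (suc n)) t
D^-polyY zero t = refl
D^-polyY (suc n) t = trans (D-resp (D^ (suc n) polyY) (permPoly (suc n)) (D^-polyY n) t) (D-permPoly n t)

theorem2p2 : (n : ℕ) → (m : Monomial) → coeff (D^ (suc n) polyY) m ≡ coeff (Qpoly (suc n)) m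
theorem2p2 n m = begin
  coeff (D^ (suc n) polyY) m                            ≡⟨ D^-polyY n m ⟩
  coeff (permPoly (suc n)) m                            ≡⟨ coeff-permPoly (suc n) m ⟩
  ∑ (λ σ → δ (weight (suc n) σ) m) (perms (suc n))      ≡⟨ sym (coeff-Qpoly (suc n) m) ⟩
  coeff (Qpoly (suc n)) m                               ∎
  where open ≡-Reasoning
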